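{- Let $n$ be even, $r \geq n/2$, and let $G$ be an $r$-regular simple graph on $n$ vertices. If $G$ contains an induced complete bipartite subgraph on all $n$ vertices of $G$ such that each of its two parts has odd cardinality, then $G$ cannot be extended to an $(r+1)$-regular graph on $n$ vertices, i.e., there is no set $F$ of edges of the complement $G^c$ such that $(V(G), E(G)\cup F)$ is $(r+1)$-regular.
   Context: All graphs are finite and simple. "Extending $G(n,r)$ to $G(n,r+1)$" means adding edges (not already present) to an $r$-regular graph on $n$ vertices, keeping the same vertex set, so that the resulting graph is $(r+1)$-regular. -}

module Defs where

open import Data.Nat using (ℕ; suc; _+_; _*_)
open import Data.Bool using (Bool; true; false; if_then_else_; _∨_; _xor_; not)
open import Data.Fin using (Fin)
open import Data.List using (List; map; allFin)
open import Data.Nat.ListAction using (sum)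
open import Data.Product using (∃-syntax)
open import Relation.Binary.PropositionalEquality using (_≡_)

record Graph (n : ℕ) : Set where
  field
    adj    : Fin n → Fin n → Bool
    sym    : ∀ u v → adj u v ≡ adj v u
    irrefl : ∀ v → adj v v ≡ false
open Graph public

countB : {n : ℕ} → (Fin n → Bool) → ℕ
countB {n} p = sum (map (λ u → if p u then 1 else 0) (allFin n))

degree : {n : ℕ} → Graph n → Fin n → ℕ
degree G v = countB (adj G v)

Regular : {n : ℕ} → ℕ → Graph n → Set
Regular r G = ∀ v → degree G v ≡ r

Even Odd : ℕ → Set
Even m = ∃[ k ] m ≡ 2 * k
Odd m = ∃[ k ] m ≡ suc (2 * k)

IsCompleteBipartiteWith : {n : ℕ} → Graph n → (Fin n → Bool) → Set
IsCompleteBipartiteWith G part = ∀ u v → adj G u v ≡ (part u xor part v)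

InComplement : {n : ℕ} → Graph n → Graph n → Set
InComplement G F = ∀ u v → adj F u v ≡ true → adj G u v ≡ false

union : {n : ℕ} → Graph n → Graph n → Graph n
union G F = record
  { adj = λ u v → adj G u v ∨ adj F u v
  ; sym = λ u v → cong₂' (sym G u v) (sym F u v)
  ; irrefl = λ v → irr (irrefl G v) (irrefl F v)
  }
  where
  cong₂' : ∀ {a b c d : Bool} → a ≡ c → b ≡ d → (a ∨ b) ≡ (c ∨ d)
  cong₂' _≡_.refl _≡_.refl = _≡_.refl
  irr : ∀ {a b : Bool} → a ≡ false → b ≡ false → (a ∨ b) ≡ false
  irr _≡_.refl _≡_.refl = _≡_.refl

-- An (r+1)-regular extension of G adds a set F of edges with every vertex
-- of degree exactly one in F, i.e. a perfect matching.  F avoids the edges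
-- of G, and in a complete bipartite graph those are exactly the pairs in
-- different parts, so F matches each part with itself.  Hence F restricted
-- to a part is 1-regular on it, and by the handshake lemma the part has an
-- even number of vertices.
module Submission where

open import Defs hiding (sym)
import Defs
open import Algebra.Properties.CommutativeMonoid.Sum as Σ using ()
open import Data.Bool using (Bool; true; false; not; if_then_else_; _∧_; _∨_; _xor_)
open import Data.Bool.Properties using (∧-assoc; ∧-comm; ∧-zeroʳ; ∧-identityʳ)
open import Data.Fin using (Fin; zero; suc)
open import Data.List using (allFin; tabulate)
open import Data.List.Properties using (map-cong; map-tabulate)
import Data.Nat.ListAction as List
open import Data.Nat using (ℕ; zero; suc; _+_; _*_; _≤_)
open import Data.Nat.Properties using (+-0-commutativeMonoid; +-comm; +-cancelˡ-≡; even≢odd)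
open import Data.Nat.Tactic.RingSolver using (solve-∀)
open import Data.Product using (∃-syntax; _×_; _,_)
open import Function using (_∘_; id)
open import Relation.Binary.PropositionalEquality
open import Relation.Nullary using (¬_)

open Σ +-0-commutativeMonoid using (sum; sum-syntax; ∑-distrib-+; sum-cong-≗; sum-replicate-zero)

𝟙 : Bool → ℕ
𝟙 b = if b then 1 else 0

sum-tabulate : ∀ {n} (f : Fin n → ℕ) → List.sum (tabulate f) ≡ sum f
sum-tabulate {zero}  f = refl
sum-tabulate {suc n} f = cong (f zero +_) (sum-tabulate (f ∘ suc))

countB≡∑ : ∀ {n} (p : Fin n → Bool) → countB p ≡ ∑[ u < n ] 𝟙 (p u)
countB≡∑ {n} p = trans (cong List.sum (map-tabulate id (𝟙 ∘ p))) (sum-tabulate (𝟙 ∘ p))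

countB-cong : ∀ {n} {p q : Fin n → Bool} → (∀ u → p u ≡ q u) → countB p ≡ countB q
countB-cong {n} p≗q = cong List.sum (map-cong (cong 𝟙 ∘ p≗q) (allFin n))

countB-false : ∀ n → countB {n} (λ _ → false) ≡ 0
countB-false n = trans (countB≡∑ {n} (λ _ → false)) (sum-replicate-zero n)

countB-∧ˡ : ∀ {n} b (p : Fin n → Bool) → countB (λ u → b ∧ p u) ≡ (if b then countB p else 0)
countB-∧ˡ     true  p = refl
countB-∧ˡ {n} false p = countB-false n

countB-∨ : ∀ {n} (p q : Fin n → Bool) → (∀ u → p u ≡ true → q u ≡ false) →
  countB (λ u → p u ∨ q u) ≡ countB p + countB q
countB-∨ {n} p q disjoint = begin
  countB (λ u → p u ∨ q u)                 ≡⟨ countB≡∑ (λ u → p u ∨ q u) ⟩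
  ∑[ u < n ] 𝟙 (p u ∨ q u)                 ≡⟨ sum-cong-≗ (λ u → 𝟙-∨ (p u) (q u) (disjoint u)) ⟩
  ∑[ u < n ] (𝟙 (p u) + 𝟙 (q u))           ≡⟨ ∑-distrib-+ (𝟙 ∘ p) (𝟙 ∘ q) ⟩
  ∑[ u < n ] 𝟙 (p u) + ∑[ u < n ] 𝟙 (q u)  ≡⟨ cong₂ _+_ (countB≡∑ p) (countB≡∑ q) ⟨
  countB p + countB q                      ∎
  where
  open ≡-Reasoning
  𝟙-∨ : ∀ a b → (a ≡ true → b ≡ false) → 𝟙 (a ∨ b) ≡ 𝟙 a + 𝟙 b
  𝟙-∨ true  b a→¬b rewrite a→¬b refl = refl
  𝟙-∨ false b _ = refl

degree≡∑ : ∀ {n} (H : Graph n) v → degree H v ≡ ∑[ w < n ] 𝟙 (adj H v w)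
degree≡∑ H v = countB≡∑ (adj H v)

removeVertexZero : ∀ {n} → Graph (suc n) → Graph n
removeVertexZero H = record
  { adj    = λ u w → adj H (suc u) (suc w)
  ; sym    = λ u w → Defs.sym H (suc u) (suc w)
  ; irrefl = irrefl H ∘ suc
  }

-- The edges at vertex zero are counted twice: in degree H zero and, through
-- symmetry, spread over the degrees of the remaining vertices.
handshake : ∀ {n} (H : Graph n) → Even (∑[ v < n ] degree H v)
handshake {zero}  H = 0 , refl
handshake {suc n} H with handshake (removeVertexZero H)
... | k , ∑deg′≡2k = d + k , (begin
  degree H zero + ∑[ u < n ] degree H (suc u)    ≡⟨ cong₂ _+_ deg-zero (sum-cong-≗ deg-suc) ⟩
  d + ∑[ u < n ] (e u + degree H′ u)             ≡⟨ cong (d +_) (∑-distrib-+ e (degree H′)) ⟩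
  d + (d + ∑[ u < n ] degree H′ u)               ≡⟨ cong (λ m → d + (d + m)) ∑deg′≡2k ⟩
  d + (d + 2 * k)                                ≡⟨ double-+ d k ⟩
  2 * (d + k)                                    ∎)
  where
  open ≡-Reasoning
  H′ = removeVertexZero H
  e : Fin n → ℕ
  e u = 𝟙 (adj H zero (suc u))
  d = ∑[ u < n ] e u
  deg-zero : degree H zero ≡ d
  deg-zero = trans (degree≡∑ H zero) (cong (λ b → 𝟙 b + d) (irrefl H zero))
  deg-suc : ∀ u → degree H (suc u) ≡ e u + degree H′ u
  deg-suc u = trans (degree≡∑ H (suc u))
    (cong₂ _+_ (cong 𝟙 (Defs.sym H (suc u) zero)) (sym (degree≡∑ H′ u)))
  double-+ : ∀ a b → a + (a + 2 * b) ≡ 2 * (a + b)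
  double-+ = solve-∀

degree-union : ∀ {n} (G F : Graph n) → InComplement G F →
  ∀ v → degree (union G F) v ≡ degree G v + degree F v
degree-union G F F⊆Gᶜ v = countB-∨ (adj G v) (adj F v) disjoint
  where
  disjoint : ∀ u → adj G v u ≡ true → adj F v u ≡ false
  disjoint u Gvu with adj F v u in Fvu
  ... | false = refl
  ... | true  with () ← trans (sym Gvu) (F⊆Gᶜ v u Fvu)

extension-isPerfectMatching : ∀ {n r} (G F : Graph n) → Regular r G → InComplement G F →
  Regular (suc r) (union G F) → Regular 1 F
extension-isPerfectMatching {r = r} G F regG F⊆Gᶜ regG∪F v = +-cancelˡ-≡ r _ _ (begin
  r + degree F v           ≡⟨ cong (_+ degree F v) (regG v) ⟨
  degree G v + degree F v  ≡⟨ degree-union G F F⊆Gᶜ v ⟨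
  degree (union G F) v     ≡⟨ regG∪F v ⟩
  suc r                    ≡⟨ +-comm 1 r ⟩
  r + 1                    ∎)
  where open ≡-Reasoning

EdgesRespect : ∀ {n} → Graph n → (Fin n → Bool) → Set
EdgesRespect H S = ∀ u w → adj H u w ≡ true → S u ≡ S w

complement-edges-respect-parts : ∀ {n} (G F : Graph n) (part : Fin n → Bool) →
  IsCompleteBipartiteWith G part → InComplement G F → EdgesRespect F part
complement-edges-respect-parts G F part bip F⊆Gᶜ u w Fuw =
  xor≡false⇒≡ (part u) (part w) (trans (sym (bip u w)) (F⊆Gᶜ u w Fuw))
  where
  xor≡false⇒≡ : ∀ a b → a xor b ≡ false → a ≡ b
  xor≡false⇒≡ true  true  _ = refl
  xor≡false⇒≡ false false _ = refl

-- The subgraph induced on S, kept on the whole vertex set: vertices outside S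
-- become isolated.
induced : ∀ {n} → Graph n → (Fin n → Bool) → Graph n
induced H S = record
  { adj    = λ u w → S u ∧ S w ∧ adj H u w
  ; sym    = λ u w → trans (sym (∧-assoc (S u) (S w) _))
                (trans (cong₂ _∧_ (∧-comm (S u) (S w)) (Defs.sym H u w)) (∧-assoc (S w) (S u) _))
  ; irrefl = λ v → trans (cong (λ b → S v ∧ S v ∧ b) (irrefl H v))
                (trans (cong (S v ∧_) (∧-zeroʳ (S v))) (∧-zeroʳ (S v)))
  }

degree-induced : ∀ {n} (H : Graph n) (S : Fin n → Bool) → Regular 1 H → EdgesRespect H S →
  ∀ v → degree (induced H S) v ≡ 𝟙 (S v)
degree-induced H S regH resp v = begin
  countB (λ w → S v ∧ S w ∧ adj H v w)  ≡⟨ countB-cong (λ w → drop-middle (S v) (S w) (adj H v w) (sym ∘ resp v w)) ⟩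
  countB (λ w → S v ∧ adj H v w)        ≡⟨ countB-∧ˡ (S v) (adj H v) ⟩
  (if S v then degree H v else 0)       ≡⟨ cong (λ d → if S v then d else 0) (regH v) ⟩
  𝟙 (S v)                               ∎
  where
  open ≡-Reasoning
  drop-middle : ∀ a b c → (c ≡ true → b ≡ a) → a ∧ b ∧ c ≡ a ∧ c
  drop-middle false b c _ = refl
  drop-middle true  b false _ = ∧-zeroʳ b
  drop-middle true  b true  b≡true = trans (∧-identityʳ b) (b≡true refl)

mainTheorem6 : (n r : ℕ) → Even n → n ≤ 2 * r → (G : Graph n) → Regular r G →
    (part : Fin n → Bool) → IsCompleteBipartiteWith G part →
    Odd (countB part) → Odd (countB (λ v → not (part v))) →
    ¬ (∃[ F ] (InComplement G F × Regular (suc r) (union G F)))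
mainTheorem6 n r _ _ G regG part bip (j , |A|≡2j+1) _ (F , F⊆Gᶜ , regG∪F)
  with handshake (induced F part)
... | k , ∑deg≡2k = even≢odd k j (begin
  2 * k                                    ≡⟨ ∑deg≡2k ⟨
  ∑[ v < n ] degree (induced F part) v     ≡⟨ sum-cong-≗ (degree-induced F part matching respects) ⟩
  ∑[ v < n ] 𝟙 (part v)                    ≡⟨ countB≡∑ part ⟨
  countB part                              ≡⟨ |A|≡2j+1 ⟩
  suc (2 * j)                              ∎)
  where
  open ≡-Reasoning
  matching : Regular 1 F
  matching = extension-isPerfectMatching G F regG F⊆Gᶜ regG∪F
  respects : EdgesRespect F part
  respects = complement-edges-respect-parts G F part bip F⊆Gᶜ
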